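{- Let $r\ge 2$ and let $F_1,\dots,F_r$ be trees. Then $k^*(F_1,\dots,F_r)\ge v(F_1)\cdots v(F_r)$.
   Context: $v(F)$ is the number of vertices of $F$. For a positive integer $k$ and forests $F_1,\dots,F_r$, the $(F_1,\dots,F_r)$-avoidance game with tree size restriction $k$ is played by Builder and Painter on a vertex-colored graph (the board), initially empty. In each step Builder adds one new vertex with edges from some previously present vertices to it, so that the board always remains a forest all of whose components have at most $k$ vertices; Painter immediately and irrevocably colors the new vertex with one of the colors $1,\dots,r$. Painter loses as soon as, for some $s$, the board contains a copy (subgraph isomorphic) of $F_s$ all of whose vertices have color $s$. Builder has a winning strategy if he can force this within finitely many steps. $k^*(F_1,\dots,F_r)$ is the smallest $k$ for which Builder has a winning strategy. -}

module Defs where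

open import Data.Nat using (ℕ; zero; suc; _*_; _≤_)
open import Data.Fin using (Fin; zero; suc)
open import Data.Bool using (Bool; true; false)
open import Data.List using (List; []; _∷_; _++_; [_]; length)
open import Data.List.Relation.Unary.All using (All)
open import Data.List.Relation.Unary.Unique.Propositional using (Unique)
open import Data.Product using (Σ; _×_)
open import Data.Unit using (⊤)
open import Data.Empty using (⊥)
open import Relation.Nullary using (¬_)
open import Relation.Binary.PropositionalEquality using (_≡_)
open import Function.Definitions using (Injective)

Adj : ℕ → Set
Adj n = Fin n → Fin n → Bool

data Connected {n : ℕ} (adj : Adj n) : Fin n → Fin n → Set where
  here : ∀ {u} → Connected adj u u
  step : ∀ {u v w} → adj u v ≡ true → Connected adj v w → Connected adj u w

Chain : {n : ℕ} → Adj n → List (Fin n) → Set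
Chain adj [] = ⊤
Chain adj (x ∷ []) = ⊤
Chain adj (x ∷ y ∷ xs) = (adj x y ≡ true) × Chain adj (y ∷ xs)

-- A cycle: distinct vertices x, x₁, ..., x_m (m ≥ 2, so at least 3 vertices)
-- with consecutive ones adjacent and x_m adjacent to x.
IsCycle : {n : ℕ} → Adj n → Fin n → List (Fin n) → Set
IsCycle adj x xs = (2 ≤ length xs) × Unique (x ∷ xs) × Chain adj (x ∷ xs ++ [ x ])

IsForest : {n : ℕ} → Adj n → Set
IsForest {n} adj = (x : Fin n) (xs : List (Fin n)) → ¬ IsCycle adj x xs

ComponentsAtMost : {n : ℕ} → ℕ → Adj n → Set
ComponentsAtMost {n} k adj =
  (v : Fin n) (us : List (Fin n)) → Unique us → All (Connected adj v) us → length us ≤ k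

record Graph : Set where
  field
    size   : ℕ
    adj    : Adj size
    sym    : ∀ u v → adj u v ≡ adj v u
    irrefl : ∀ u → adj u u ≡ false

open Graph public

v : Graph → ℕ
v = Graph.size

record IsTree (F : Graph) : Set where
  field
    nonempty  : 1 ≤ size F
    connected : ∀ u w → Connected (adj F) u w
    acyclic   : IsForest (adj F)

record Board (r : ℕ) : Set where
  field
    bsize : ℕ
    badj  : Adj bsize
    col   : Fin bsize → Fin r

open Board public

emptyBoard : {r : ℕ} → Board r
emptyBoard = record { bsize = 0 ; badj = λ () ; col = λ () }

-- adjacency after adding a new vertex (index zero) joined to the set S of old vertices
extendAdj : {n : ℕ} → Adj n → (Fin n → Bool) → Adj (suc n)
extendAdj adj S zero zero = false
extendAdj adj S zero (suc j) = S j
extendAdj adj S (suc i) zero = S i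
extendAdj adj S (suc i) (suc j) = adj i j

extendCol : {n r : ℕ} → (Fin n → Fin r) → Fin r → Fin (suc n) → Fin r
extendCol col c zero = c
extendCol col c (suc i) = col i

extend : {r : ℕ} (B : Board r) → (Fin (bsize B) → Bool) → Fin r → Board r
extend B S c = record
  { bsize = suc (bsize B) ; badj = extendAdj (badj B) S ; col = extendCol (col B) c }

Legal : {r : ℕ} → ℕ → (B : Board r) → (Fin (bsize B) → Bool) → Set
Legal k B S = IsForest (extendAdj (badj B) S) × ComponentsAtMost k (extendAdj (badj B) S)

MonoCopy : {r : ℕ} → Graph → Fin r → Board r → Set
MonoCopy F s B =
  Σ (Fin (size F) → Fin (bsize B)) λ f →
    Injective _≡_ _≡_ f
    × (∀ a b → adj F a b ≡ true → badj B (f a) (f b) ≡ true)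
    × (∀ a → col B (f a) ≡ s)

PainterLost : {r : ℕ} → (Fin r → Graph) → Board r → Set
PainterLost {r} F B = Σ (Fin r) λ s → MonoCopy (F s) s B

-- Builder can force Painter's loss within finitely many steps from board B
-- (inductive, hence well-founded game tree).
data BuilderWinsFrom {r : ℕ} (k : ℕ) (F : Fin r → Graph) : Board r → Set where
  lost : ∀ {B} → PainterLost F B → BuilderWinsFrom k F B
  move : ∀ {B} (S : Fin (bsize B) → Bool) → Legal k B S →
         (∀ c → BuilderWinsFrom k F (extend B S c)) → BuilderWinsFrom k F B

BuilderWins : {r : ℕ} → ℕ → (Fin r → Graph) → Set
BuilderWins k F = BuilderWinsFrom k F emptyBoard

prod : (n : ℕ) → (Fin n → ℕ) → ℕ
prod zero f = 1
prod (suc n) f = f zero * prod n (λ i → f (suc i))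

module Submission where

-- We give a Painter strategy that survives against every Builder strategy
-- whose tree size restriction k is below a₀⋯a_{r-1}.  Painter keeps two
-- labellings of the board (an `Invariant`): a monochromatic labelling, whose
-- classes are one-coloured, contain every monochromatic edge and have fewer
-- than a t vertices when of colour t; and a block labelling, coarser than the
-- monochromatic one, whose classes are connected and where the block of x has
-- at least |mono class of x| · a₀⋯a_{t-1} vertices (t = colour of x).
-- When a new vertex is joined to a set S, let N t be the total size of the
-- colour-t monochromatic classes met by S, and NB that of the blocks met by S.
-- Since the board stays a forest, distinct neighbours lie in distinct blocks,
-- whence Σ_t a₀⋯a_{t-1}·N t ≤ NB.  If N t + 1 < a t for some t, Painter uses
-- the first such colour and the invariant is restored by merging classes;
-- otherwise a₀⋯a_{r-1} ≤ 1 + NB, which is at most the size of the new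
-- component, hence at most k.  Finally a monochromatic copy of a tree F s is
-- connected, so it lies in one monochromatic class, of size < a s.

open import Defs hiding (sym)
open import Data.Nat using (ℕ; zero; suc; _+_; _*_; _≤_; _<_; z≤n; s≤s; _≤?_)
import Data.Nat as ℕ
open import Data.Nat.Properties
open import Data.Fin using (Fin; zero; suc; Fin′; inject; fromℕ<)
import Data.Fin.Properties as Fin
open import Data.Bool using (Bool; true; false; _∧_; _∨_; if_then_else_)
open import Data.Bool.Properties using (∧-conicalˡ; ∧-conicalʳ)
open import Data.List using (List; []; _∷_; _++_; [_]; map; length; tabulate)
open import Data.List.Properties using (length-map; length-tabulate)
open import Data.List.Relation.Unary.All using (All; []; _∷_; universal) renaming (map to All-map)
import Data.List.Relation.Unary.All.Properties as All
open import Data.List.Relation.Unary.Any using (here; there; any?)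
open import Data.List.Relation.Unary.AllPairs using ([]; _∷_)
open import Data.List.Relation.Unary.Unique.Propositional using (Unique)
import Data.List.Relation.Unary.Unique.Propositional.Properties as Unique
open import Data.List.Membership.Propositional using (_∈_)
open import Data.Product using (Σ; _×_; _,_)
open import Data.Sum using (_⊎_; inj₁; inj₂)
open import Data.Empty using (⊥; ⊥-elim)
open import Function using (_∘_)
open import Relation.Nullary using (¬_; Dec; yes; no; does)
open import Relation.Nullary.Decidable using (dec-true; dec-false)
open import Relation.Binary.Definitions using (DecidableEquality)
open import Relation.Binary.PropositionalEquality hiding ([_])
open import Algebra.Properties.Semiring.Sum +-*-semiring
  using (sum; sum-cong-≗; sum-replicate-zero; ∑-comm; *-distribˡ-sum)

sum-mono-≤ : ∀ {n} {f g : Fin n → ℕ} → (∀ i → f i ≤ g i) → sum f ≤ sum g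
sum-mono-≤ {zero} f≤g = z≤n
sum-mono-≤ {suc n} f≤g = +-mono-≤ (f≤g zero) (sum-mono-≤ (f≤g ∘ suc))

sum-zero : ∀ {n} (f : Fin n → ℕ) → (∀ i → f i ≡ 0) → sum f ≡ 0
sum-zero {n} f f≡0 = trans (sum-cong-≗ f≡0) (sum-replicate-zero n)

sum-at : ∀ {r} (c : Fin r) (h : Fin r → ℕ) →
  sum (λ t → if does (c Fin.≟ t) then h t else 0) ≡ h c
sum-at {suc r} zero h = trans (cong (h zero +_) (sum-zero {r} _ (λ _ → refl))) (+-identityʳ _)
sum-at {suc r} (suc c) h = sum-at c (h ∘ suc)

module BoolEquality {A : Set} (_≟_ : DecidableEquality A) where
  infix 5 _==_
  _==_ : A → A → Bool
  x == y = does (x ≟ y)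

  ==-sound : ∀ x y → x == y ≡ true → x ≡ y
  ==-sound x y x==y with x ≟ y
  ... | yes x≡y = x≡y
  ==-sound x y () | no _

  ==-complete : ∀ x y → x ≡ y → x == y ≡ true
  ==-complete x y = dec-true (x ≟ y)

  ==-refl : ∀ x → x == x ≡ true
  ==-refl x = ==-complete x x refl

  ==-false : ∀ x y → x ≢ y → x == y ≡ false
  ==-false x y = dec-false (x ≟ y)

open BoolEquality ℕ._≟_

∧-split : ∀ b c → b ∧ c ≡ true → b ≡ true × c ≡ true
∧-split b c e = ∧-conicalˡ b c e , ∧-conicalʳ b c e

∨-split : ∀ b c → b ∨ c ≡ true → b ≡ true ⊎ c ≡ true
∨-split true c _ = inj₁ refl
∨-split false c e = inj₂ e

ind : Bool → ℕ
ind true = 1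
ind false = 0

ind-false : ∀ b → ¬ b ≡ true → ind b ≡ 0
ind-false true b≢true = ⊥-elim (b≢true refl)
ind-false false _ = refl

count : ∀ {n} → (Fin n → Bool) → ℕ
count p = sum (λ y → ind (p y))

exists : ∀ {n} → (Fin n → Bool) → Bool
exists {zero} h = false
exists {suc n} h = h zero ∨ exists (h ∘ suc)

exists-elim : ∀ {n} (h : Fin n → Bool) → exists h ≡ true → Σ (Fin n) λ i → h i ≡ true
exists-elim {suc n} h e with ∨-split (h zero) _ e
... | inj₁ h0 = zero , h0
... | inj₂ rest with exists-elim (h ∘ suc) rest
... | i , hi = suc i , hi

exists-intro : ∀ {n} (h : Fin n → Bool) (i : Fin n) → h i ≡ true → exists h ≡ true
exists-intro h zero hi rewrite hi = refl
exists-intro h (suc i) hi with h zero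
... | true = refl
... | false = exists-intro (h ∘ suc) i hi

count-mono : ∀ {n} (p q : Fin n → Bool) → (∀ y → p y ≡ true → q y ≡ true) → count p ≤ count q
count-mono p q p⇒q = sum-mono-≤ pointwise
  where
  pointwise : ∀ y → ind (p y) ≤ ind (q y)
  pointwise y with p y in py
  ... | true rewrite p⇒q y py = ≤-refl
  ... | false = z≤n

count-∧ : ∀ {n} (b : Bool) (p : Fin n → Bool) →
  count (λ y → b ∧ p y) ≡ (if b then count p else 0)
count-∧ true p = refl
count-∧ {n} false p = sum-zero {n} _ (λ _ → refl)

count-exists-≤ : ∀ {n m} (q : Fin m → Fin n → Bool) →
  count (λ y → exists (λ i → q i y)) ≤ sum (λ i → count (q i))
count-exists-≤ q =
  ≤-trans (sum-mono-≤ (λ y → ind-exists (λ i → q i y))) (≤-reflexive (∑-comm (λ y i → ind (q i y))))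
  where
  ind-∨ : ∀ b c → ind (b ∨ c) ≤ ind b + ind c
  ind-∨ true c = s≤s z≤n
  ind-∨ false c = ≤-refl

  ind-exists : ∀ {m} (h : Fin m → Bool) → ind (exists h) ≤ sum (λ i → ind (h i))
  ind-exists {zero} h = z≤n
  ind-exists {suc m} h =
    ≤-trans (ind-∨ (h zero) (exists (h ∘ suc))) (+-monoʳ-≤ (ind (h zero)) (ind-exists (h ∘ suc)))

count-exists-≥ : ∀ {n m} (q : Fin m → Fin n → Bool) →
  (∀ y i j → q i y ≡ true → q j y ≡ true → i ≡ j) →
  sum (λ i → count (q i)) ≤ count (λ y → exists (λ i → q i y))
count-exists-≥ q disjoint =
  ≤-trans (≤-reflexive (sym (∑-comm (λ y i → ind (q i y))))) (sum-mono-≤ (λ y → ind-exists (λ i → q i y) (disjoint y)))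
  where
  ind-exists : ∀ {m} (h : Fin m → Bool) → (∀ i j → h i ≡ true → h j ≡ true → i ≡ j) →
    sum (λ i → ind (h i)) ≤ ind (exists h)
  ind-exists {zero} h once = z≤n
  ind-exists {suc m} h once with h zero in h0
  ... | true rewrite sum-zero (λ i → ind (h (suc i)))
                       (λ i → ind-false (h (suc i)) (Fin.0≢1+n ∘ once zero (suc i) h0)) = s≤s z≤n
  ... | false = ind-exists (h ∘ suc) (λ i j hi hj → Fin.suc-injective (once (suc i) (suc j) hi hj))

zero∉map-suc : ∀ {n} (xs : List (Fin n)) → All (zero ≢_) (map suc xs)
zero∉map-suc xs = All.map⁺ (universal (λ _ → Fin.0≢1+n) xs)

enumerate : ∀ {n} → (Fin n → Bool) → List (Fin n)
enumerate {zero} p = []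
enumerate {suc n} p with p zero
... | true = zero ∷ map suc (enumerate (p ∘ suc))
... | false = map suc (enumerate (p ∘ suc))

enumerate-length : ∀ {n} (p : Fin n → Bool) → length (enumerate p) ≡ count p
enumerate-length {zero} p = refl
enumerate-length {suc n} p with p zero
... | true = cong suc (trans (length-map suc (enumerate (p ∘ suc))) (enumerate-length (p ∘ suc)))
... | false = trans (length-map suc (enumerate (p ∘ suc))) (enumerate-length (p ∘ suc))

enumerate-sound : ∀ {n} (p : Fin n → Bool) → All (λ y → p y ≡ true) (enumerate p)
enumerate-sound {zero} p = []
enumerate-sound {suc n} p with p zero in p0
... | true = p0 ∷ All.map⁺ (enumerate-sound (p ∘ suc))
... | false = All.map⁺ (enumerate-sound (p ∘ suc))

enumerate-unique : ∀ {n} (p : Fin n → Bool) → Unique (enumerate p)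
enumerate-unique {zero} p = []
enumerate-unique {suc n} p with p zero
... | true = zero∉map-suc _ ∷ Unique.map⁺ Fin.suc-injective (enumerate-unique (p ∘ suc))
... | false = Unique.map⁺ Fin.suc-injective (enumerate-unique (p ∘ suc))

predecessors : ∀ {n} → List (Fin (suc n)) → List (Fin n)
predecessors [] = []
predecessors (zero ∷ xs) = predecessors xs
predecessors (suc x ∷ xs) = x ∷ predecessors xs

predecessors-all : ∀ {n} {P : Fin (suc n) → Set} (xs : List (Fin (suc n))) →
  All P xs → All (P ∘ suc) (predecessors xs)
predecessors-all [] [] = []
predecessors-all (zero ∷ xs) (_ ∷ ps) = predecessors-all xs ps
predecessors-all (suc x ∷ xs) (p ∷ ps) = p ∷ predecessors-all xs ps

predecessors-unique : ∀ {n} (xs : List (Fin (suc n))) → Unique xs → Unique (predecessors xs)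
predecessors-unique [] [] = []
predecessors-unique (zero ∷ xs) (_ ∷ u) = predecessors-unique xs u
predecessors-unique (suc x ∷ xs) (x∉xs ∷ u) =
  All-map (λ x≢y x≡y → x≢y (cong suc x≡y)) (predecessors-all xs x∉xs) ∷ predecessors-unique xs u

-- Only a list containing zero loses an entry, and then zero satisfies p.
length-predecessors : ∀ {n} (p : Fin (suc n) → Bool) (xs : List (Fin (suc n))) →
  Unique xs → All (λ y → p y ≡ true) xs → length xs ≤ ind (p zero) + length (predecessors xs)
length-predecessors p [] [] [] = z≤n
length-predecessors p (zero ∷ xs) (zero∉xs ∷ _) (p0 ∷ _) rewrite p0 = s≤s (no-zero xs zero∉xs)
  where
  no-zero : ∀ {n} (ys : List (Fin (suc n))) → All (zero ≢_) ys → length ys ≤ length (predecessors ys)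
  no-zero [] [] = z≤n
  no-zero (zero ∷ ys) (z≢z ∷ _) = ⊥-elim (z≢z refl)
  no-zero (suc y ∷ ys) (_ ∷ zs) = s≤s (no-zero ys zs)
length-predecessors p (suc x ∷ xs) (_ ∷ u) (_ ∷ ps) =
  ≤-trans (s≤s (length-predecessors p xs u ps)) (≤-reflexive (sym (+-suc (ind (p zero)) _)))

unique-length≤count : ∀ {n} (p : Fin n → Bool) (xs : List (Fin n)) →
  Unique xs → All (λ y → p y ≡ true) xs → length xs ≤ count p
unique-length≤count {zero} p [] _ _ = z≤n
unique-length≤count {suc n} p xs u ps = ≤-trans (length-predecessors p xs u ps)
  (+-monoʳ-≤ (ind (p zero))
    (unique-length≤count (p ∘ suc) (predecessors xs) (predecessors-unique xs u) (predecessors-all xs ps)))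

prefix : (r : ℕ) → (Fin r → ℕ) → Fin r → ℕ
prefix (suc r) a zero = 1
prefix (suc r) a (suc t) = a zero * prefix r (a ∘ suc) t

weighted : (r : ℕ) → (Fin r → ℕ) → (Fin r → ℕ) → ℕ
weighted r a N = sum (λ t → prefix r a t * N t)

weighted-suc : ∀ r (a N : Fin (suc r) → ℕ) →
  weighted (suc r) a N ≡ N zero + a zero * weighted r (a ∘ suc) (N ∘ suc)
weighted-suc r a N = cong₂ _+_ (+-identityʳ (N zero)) (begin
    sum (λ t → a zero * prefix r (a ∘ suc) t * N (suc t))
      ≡⟨ sum-cong-≗ (λ t → *-assoc (a zero) (prefix r (a ∘ suc) t) (N (suc t))) ⟩
    sum (λ t → a zero * (prefix r (a ∘ suc) t * N (suc t)))
      ≡⟨ *-distribˡ-sum (a zero) (λ t → prefix r (a ∘ suc) t * N (suc t)) ⟨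
    a zero * weighted r (a ∘ suc) (N ∘ suc) ∎)
  where open ≡-Reasoning

prod≤1+weighted : ∀ r (a N : Fin r → ℕ) → (∀ t → a t ≤ suc (N t)) →
  prod r a ≤ suc (weighted r a N)
prod≤1+weighted zero a N full = ≤-refl
prod≤1+weighted (suc r) a N full = begin
    a zero * prod r (a ∘ suc)  ≤⟨ *-monoʳ-≤ (a zero) (prod≤1+weighted r (a ∘ suc) (N ∘ suc) (full ∘ suc)) ⟩
    a zero * suc W             ≡⟨ *-suc (a zero) W ⟩
    a zero + a zero * W        ≤⟨ +-monoˡ-≤ (a zero * W) (full zero) ⟩
    suc (N zero + a zero * W)  ≡⟨ cong suc (weighted-suc r a N) ⟨
    suc (weighted (suc r) a N) ∎
  where
  open ≤-Reasoning
  W = weighted r (a ∘ suc) (N ∘ suc)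

first-term≤1+weighted : ∀ r (a N : Fin r → ℕ) (s : Fin r) →
  ((j : Fin′ s) → a (inject j) ≤ suc (N (inject j))) →
  suc (N s) * prefix r a s ≤ suc (weighted r a N)
first-term≤1+weighted (suc r) a N zero _ = begin
    suc (N zero) * 1             ≡⟨ *-identityʳ (suc (N zero)) ⟩
    suc (N zero)                 ≤⟨ s≤s (m≤m+n (N zero) _) ⟩
    suc (N zero + a zero * W)    ≡⟨ cong suc (weighted-suc r a N) ⟨
    suc (weighted (suc r) a N) ∎
  where
  open ≤-Reasoning
  W = weighted r (a ∘ suc) (N ∘ suc)
first-term≤1+weighted (suc r) a N (suc s) earlier = begin
    suc (N (suc s)) * (a zero * prefix r (a ∘ suc) s)
      ≡⟨ *-assoc (suc (N (suc s))) (a zero) _ ⟨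
    suc (N (suc s)) * a zero * prefix r (a ∘ suc) s
      ≡⟨ cong (_* prefix r (a ∘ suc) s) (*-comm (suc (N (suc s))) (a zero)) ⟩
    a zero * suc (N (suc s)) * prefix r (a ∘ suc) s
      ≡⟨ *-assoc (a zero) (suc (N (suc s))) _ ⟩
    a zero * (suc (N (suc s)) * prefix r (a ∘ suc) s)
      ≤⟨ *-monoʳ-≤ (a zero) (first-term≤1+weighted r (a ∘ suc) (N ∘ suc) s (earlier ∘ suc)) ⟩
    a zero * suc W            ≡⟨ *-suc (a zero) W ⟩
    a zero + a zero * W       ≤⟨ +-monoˡ-≤ (a zero * W) (earlier zero) ⟩
    suc (N zero + a zero * W) ≡⟨ cong suc (weighted-suc r a N) ⟨
    suc (weighted (suc r) a N) ∎
  where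
  open ≤-Reasoning
  W = weighted r (a ∘ suc) (N ∘ suc)

connected-trans : ∀ {n} {adj : Adj n} {x y z} →
  Connected adj x y → Connected adj y z → Connected adj x z
connected-trans here c = c
connected-trans (step e c) d = step e (connected-trans c d)

connected-lift : ∀ {n} {adj : Adj n} {S : Fin n → Bool} {x y} →
  Connected adj x y → Connected (extendAdj adj S) (suc x) (suc y)
connected-lift here = here
connected-lift (step e c) = step e (connected-lift c)

Path : ∀ {n} → Adj n → Fin n → List (Fin n) → Fin n → Set
Path adj u [] w = u ≡ w
Path adj u (x ∷ xs) w = adj u x ≡ true × Path adj x xs w

path-from : ∀ {n} {adj : Adj n} {u w : Fin n} (z : Fin n) (zs : List (Fin n)) →
  Path adj z zs w → Unique (z ∷ zs) → u ∈ (z ∷ zs) →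
  Σ (List (Fin n)) λ rest → Path adj u rest w × Unique (u ∷ rest)
path-from z zs path u (here refl) = zs , path , u
path-from z (z′ ∷ zs) (_ , path) (_ ∷ u) (there u∈zs) = path-from z′ zs path u u∈zs

simple-path : ∀ {n} {adj : Adj n} {u w : Fin n} → Connected adj u w →
  Σ (List (Fin n)) λ ws → Path adj u ws w × Unique (u ∷ ws)
simple-path here = [] , refl , [] ∷ []
simple-path {u = u} (step {v = v} e c) with simple-path c
... | ws , path , u′ with any? (u Fin.≟_) (v ∷ ws)
... | yes u∈ = path-from v ws path u′ u∈
... | no u∉ = v ∷ ws , (e , path) , All.¬Any⇒All¬ (v ∷ ws) u∉ ∷ u′

closed-chain : ∀ {n} {adj : Adj n} {S : Fin n → Bool} {j : Fin n} (i : Fin n) (ws : List (Fin n)) →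
  Path adj i ws j → S j ≡ true → Chain (extendAdj adj S) (suc i ∷ (map suc ws ++ [ zero ]))
closed-chain i [] refl sj = sj , _
closed-chain i (x ∷ ws) (e , path) sj = e , closed-chain x ws path sj

neighbours-separated : ∀ {n} {adj : Adj n} {S : Fin n → Bool} → IsForest (extendAdj adj S) →
  (i j : Fin n) → S i ≡ true → S j ≡ true → Connected adj i j → i ≡ j
neighbours-separated forest i j si sj c with i Fin.≟ j
... | yes i≡j = i≡j
... | no i≢j with simple-path c
... | [] , refl , _ = ⊥-elim (i≢j refl)
... | x ∷ ws , path , u = ⊥-elim (forest zero (map suc (i ∷ x ∷ ws))
        (s≤s (s≤s z≤n) , zero∉map-suc (i ∷ x ∷ ws) ∷ Unique.map⁺ Fin.suc-injective u ,
         si , closed-chain i (x ∷ ws) path sj))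

-- Labellings.  A labelling L : Fin n → ℕ partitions the vertices; the class
-- of x has classSize L x vertices.

classSize : ∀ {n} → (Fin n → ℕ) → Fin n → ℕ
classSize L x = count (λ y → L y == L x)

-- Labels are below n;
-- the new vertex, and every old vertex whose label is selected by `merged`,
-- receive the fresh label n, and the other labels are unchanged.
module Merge (n : ℕ) (merged : ℕ → Bool) (L : Fin n → ℕ) (L< : ∀ x → L x < n) where
  relabel : ℕ → ℕ
  relabel ℓ = if merged ℓ then n else ℓ

  L⁺ : Fin (suc n) → ℕ
  L⁺ zero = n
  L⁺ (suc y) = relabel (L y)

  L⁺< : ∀ x → L⁺ x < suc n
  L⁺< zero = ≤-refl
  L⁺< (suc y) with merged (L y)
  ... | true = ≤-refl
  ... | false = m≤n⇒m≤1+n (L< y)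

  fresh≢old : ∀ y → n ≢ L y
  fresh≢old y n≡Ly = <-irrefl (sym n≡Ly) (L< y)

  old-label : ∀ y → (merged (L y) ≡ true × L⁺ (suc y) ≡ n) ⊎ (merged (L y) ≡ false × L⁺ (suc y) ≡ L y)
  old-label y with merged (L y)
  ... | true = inj₁ (refl , refl)
  ... | false = inj₂ (refl , refl)

  fresh⇒merged : ∀ y → L⁺ (suc y) ≡ n → merged (L y) ≡ true
  fresh⇒merged y fresh with old-label y
  ... | inj₁ (m , _) = m
  ... | inj₂ (_ , kept) = ⊥-elim (fresh≢old y (trans (sym fresh) kept))

  merged⇒fresh : ∀ y → merged (L y) ≡ true → L⁺ (suc y) ≡ n
  merged⇒fresh y m rewrite m = refl

  same-label : ∀ x y → L⁺ x ≡ L⁺ y → (L⁺ x ≡ n × L⁺ y ≡ n) ⊎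
    Σ (Fin n) λ x′ → Σ (Fin n) λ y′ → x ≡ suc x′ × y ≡ suc y′ × L x′ ≡ L y′
  same-label zero y e = inj₁ (refl , sym e)
  same-label (suc x) y e with old-label x
  ... | inj₁ (_ , fx) = inj₁ (fx , trans (sym e) fx)
  same-label (suc x) zero e | inj₂ (_ , kx) = ⊥-elim (fresh≢old x (trans (sym e) kx))
  same-label (suc x) (suc y) e | inj₂ (_ , kx) with old-label y
  ... | inj₁ (_ , fy) = ⊥-elim (fresh≢old x (trans (sym fy) (trans (sym e) kx)))
  ... | inj₂ (_ , ky) = inj₂ (x , y , refl , refl , trans (sym kx) (trans e ky))

  fresh-class-size : ∀ x → L⁺ x ≡ n → classSize L⁺ x ≡ suc (count (λ y → merged (L y)))
  fresh-class-size x fresh rewrite fresh | ==-refl n = cong suc (sum-cong-≗ (λ y → cong ind (fresh-test y)))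
    where
    fresh-test : ∀ y → L⁺ (suc y) == n ≡ merged (L y)
    fresh-test y with old-label y
    ... | inj₁ (m , fy) rewrite fy | m = ==-refl n
    ... | inj₂ (m , ky) rewrite ky | m = ==-false (L y) n (fresh≢old y ∘ sym)

  unmerged-kept : ∀ x → merged (L x) ≡ false → L⁺ (suc x) ≡ L x
  unmerged-kept x unmerged rewrite unmerged = refl

  unmerged-class-size : ∀ x → merged (L x) ≡ false → classSize L⁺ (suc x) ≤ classSize L x
  unmerged-class-size x unmerged
    rewrite unmerged-kept x unmerged | ==-false n (L x) (fresh≢old x) = count-mono _ _ still-same
    where
    still-same : ∀ y → L⁺ (suc y) == L x ≡ true → L y == L x ≡ true
    still-same y e with old-label y
    ... | inj₁ (_ , fy) = ⊥-elim (fresh≢old x (trans (sym fy) (==-sound _ _ e)))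
    ... | inj₂ (_ , ky) = subst (λ ℓ → ℓ == L x ≡ true) ky e

  class-size-grows : ∀ x → classSize L x ≤ classSize L⁺ (suc x)
  class-size-grows x = ≤-trans (count-mono _ _ still-same) (m≤n+m _ (ind (n == L⁺ (suc x))))
    where
    still-same : ∀ y → L y == L x ≡ true → L⁺ (suc y) == L⁺ (suc x) ≡ true
    still-same y e = ==-complete _ _ (cong relabel (==-sound _ _ e))

module PainterStrategy (r : ℕ) (a : Fin r → ℕ) where
  open BoolEquality (Fin._≟_ {r}) using ()
    renaming (_==_ to _==ᶜ_; ==-sound to ==ᶜ-sound; ==-complete to ==ᶜ-complete)

  record Invariant (B : Board r) : Set where
    field
      mono block : Fin (bsize B) → ℕ
      mono< : ∀ x → mono x < bsize B
      block< : ∀ x → block x < bsize B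
      mono-edge : ∀ x y → badj B x y ≡ true → col B x ≡ col B y → mono x ≡ mono y
      mono-colour : ∀ x y → mono x ≡ mono y → col B x ≡ col B y
      mono⊆block : ∀ x y → mono x ≡ mono y → block x ≡ block y
      block-connected : ∀ x y → block x ≡ block y → Connected (badj B) x y
      mono-small : ∀ x → classSize mono x < a (col B x)
      block-large : ∀ x → classSize mono x * prefix r a (col B x) ≤ classSize block x

  initial : Invariant emptyBoard
  initial = record
    { mono = λ () ; block = λ () ; mono< = λ () ; block< = λ ()
    ; mono-edge = λ () ; mono-colour = λ () ; mono⊆block = λ () ; block-connected = λ ()
    ; mono-small = λ () ; block-large = λ () }

  module Move {B : Board r} (I : Invariant B) (S : Fin (bsize B) → Bool)
              (forest : IsForest (extendAdj (badj B) S)) where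
    open Invariant I

    n : ℕ
    n = bsize B

    adj⁺ : Adj (suc n)
    adj⁺ = extendAdj (badj B) S

    meetsMono : Fin r → ℕ → Bool
    meetsMono t ℓ = exists (λ i → (S i ∧ (col B i ==ᶜ t)) ∧ (ℓ == mono i))

    N : Fin r → ℕ
    N t = count (λ y → meetsMono t (mono y))

    meetsBlock : ℕ → Bool
    meetsBlock ℓ = exists (λ i → S i ∧ (ℓ == block i))

    NB : ℕ
    NB = count (λ y → meetsBlock (block y))

    N≤contributions : ∀ t →
      N t ≤ sum (λ i → if (S i ∧ (col B i ==ᶜ t)) then classSize mono i else 0)
    N≤contributions t =
      ≤-trans (count-exists-≤ (λ i y → (S i ∧ (col B i ==ᶜ t)) ∧ (mono y == mono i)))
        (≤-reflexive (sum-cong-≗ (λ i → count-∧ (S i ∧ (col B i ==ᶜ t)) (λ y → mono y == mono i))))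

    weighted-class≤block : ∀ i →
      sum (λ t → prefix r a t * (if (S i ∧ (col B i ==ᶜ t)) then classSize mono i else 0))
        ≤ (if S i then classSize block i else 0)
    weighted-class≤block i with S i
    ... | false = ≤-reflexive (sum-zero _ (λ t → *-zeroʳ (prefix r a t)))
    ... | true = begin
        sum (λ t → prefix r a t * (if col B i ==ᶜ t then classSize mono i else 0))
          ≡⟨ sum-cong-≗ (λ t → *-if (prefix r a t) (col B i ==ᶜ t)) ⟩
        sum (λ t → if col B i ==ᶜ t then prefix r a t * classSize mono i else 0)
          ≡⟨ sum-at (col B i) (λ t → prefix r a t * classSize mono i) ⟩
        prefix r a (col B i) * classSize mono i
          ≡⟨ *-comm (prefix r a (col B i)) (classSize mono i) ⟩
        classSize mono i * prefix r a (col B i)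
          ≤⟨ block-large i ⟩
        classSize block i ∎
      where
      open ≤-Reasoning
      *-if : ∀ p b → p * (if b then classSize mono i else 0) ≡ (if b then p * classSize mono i else 0)
      *-if p true = refl
      *-if p false = *-zeroʳ p

    blocks-disjoint : ∀ y i j → S i ∧ (block y == block i) ≡ true → S j ∧ (block y == block j) ≡ true → i ≡ j
    blocks-disjoint y i j yi yj with ∧-split (S i) _ yi | ∧-split (S j) _ yj
    ... | si , bi | sj , bj = neighbours-separated forest i j si sj
          (block-connected i j (trans (sym (==-sound (block y) _ bi)) (==-sound (block y) _ bj)))

    weighted-N≤NB : weighted r a N ≤ NB
    weighted-N≤NB = begin
      sum (λ t → prefix r a t * N t)
        ≤⟨ sum-mono-≤ (λ t → *-monoʳ-≤ (prefix r a t) (N≤contributions t)) ⟩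
      sum (λ t → prefix r a t * sum (λ i → contribution t i))
        ≡⟨ sum-cong-≗ (λ t → *-distribˡ-sum (prefix r a t) (contribution t)) ⟩
      sum (λ t → sum (λ i → prefix r a t * contribution t i))
        ≡⟨ ∑-comm (λ t i → prefix r a t * contribution t i) ⟩
      sum (λ i → sum (λ t → prefix r a t * contribution t i))
        ≤⟨ sum-mono-≤ weighted-class≤block ⟩
      sum (λ i → if S i then classSize block i else 0)
        ≡⟨ sum-cong-≗ (λ i → count-∧ (S i) (λ y → block y == block i)) ⟨
      sum (λ i → count (λ y → S i ∧ (block y == block i)))
        ≤⟨ count-exists-≥ (λ i y → S i ∧ (block y == block i)) blocks-disjoint ⟩
      NB ∎
      where
      open ≤-Reasoning
      contribution : Fin r → Fin n → ℕ
      contribution t i = if (S i ∧ (col B i ==ᶜ t)) then classSize mono i else 0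

    module NewBlock = Merge n meetsBlock block block<
    open NewBlock using () renaming (L⁺ to block⁺)

    merged-block : ∀ y → meetsBlock (block y) ≡ true → Σ (Fin n) λ i → S i ≡ true × block y ≡ block i
    merged-block y meets with exists-elim _ meets
    ... | i , yi with ∧-split (S i) _ yi
    ... | si , same = i , si , ==-sound _ _ same

    fresh-block-from : ∀ x → block⁺ x ≡ n → Connected adj⁺ zero x
    fresh-block-from zero _ = here
    fresh-block-from (suc y) fresh with merged-block y (NewBlock.fresh⇒merged y fresh)
    ... | i , si , same = step si (connected-lift (block-connected i y (sym same)))

    fresh-block-to : ∀ x → block⁺ x ≡ n → Connected adj⁺ x zero
    fresh-block-to zero _ = here
    fresh-block-to (suc y) fresh with merged-block y (NewBlock.fresh⇒merged y fresh)
    ... | i , si , same = connected-trans (connected-lift (block-connected y i same)) (step si here)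

    all-full⇒large : ∀ k → ComponentsAtMost k adj⁺ → (∀ t → a t ≤ suc (N t)) → prod r a ≤ k
    all-full⇒large k components≤k full = begin
      prod r a                        ≤⟨ prod≤1+weighted r a N full ⟩
      suc (weighted r a N)            ≤⟨ s≤s weighted-N≤NB ⟩
      suc NB                          ≡⟨ NewBlock.fresh-class-size zero refl ⟨
      count fresh                     ≡⟨ enumerate-length fresh ⟨
      length (enumerate fresh)        ≤⟨ components≤k zero (enumerate fresh) (enumerate-unique fresh)
                                          (All-map (λ {x} e → fresh-block-from x (==-sound _ _ e)) (enumerate-sound fresh)) ⟩
      k ∎
      where
      open ≤-Reasoning
      fresh : Fin (suc n) → Bool
      fresh y = block⁺ y == n

    module Answer (s : Fin r) (s-free : suc (N s) < a s)
                  (earlier-full : (j : Fin′ s) → a (inject j) ≤ suc (N (inject j))) where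
      module NewMono = Merge n (meetsMono s) mono mono<
      open NewMono using () renaming (L⁺ to mono⁺)

      colour⁺ : Fin (suc n) → Fin r
      colour⁺ = extendCol (col B) s

      merged-mono : ∀ y → meetsMono s (mono y) ≡ true →
        Σ (Fin n) λ i → S i ≡ true × col B i ≡ s × mono y ≡ mono i
      merged-mono y meets with exists-elim _ meets
      ... | i , yi with ∧-split _ _ yi
      ... | si∧ci , same with ∧-split (S i) _ si∧ci
      ... | si , ci = i , si , ==ᶜ-sound _ _ ci , ==-sound _ _ same

      fresh-mono-colour : ∀ x → mono⁺ x ≡ n → colour⁺ x ≡ s
      fresh-mono-colour zero _ = refl
      fresh-mono-colour (suc y) fresh with merged-mono y (NewMono.fresh⇒merged y fresh)
      ... | i , _ , ci , same = trans (mono-colour y i same) ci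

      fresh-mono⇒fresh-block : ∀ x → mono⁺ x ≡ n → block⁺ x ≡ n
      fresh-mono⇒fresh-block zero _ = refl
      fresh-mono⇒fresh-block (suc y) fresh with merged-mono y (NewMono.fresh⇒merged y fresh)
      ... | i , si , _ , same =
        NewBlock.merged⇒fresh y (exists-intro _ i (cong₂ _∧_ si (==-complete _ _ (mono⊆block y i same))))

      neighbour-fresh : ∀ j → S j ≡ true → col B j ≡ s → mono⁺ (suc j) ≡ n
      neighbour-fresh j sj cj = NewMono.merged⇒fresh j (exists-intro _ j
        (cong₂ _∧_ (cong₂ _∧_ sj (==ᶜ-complete (col B j) s cj)) (==-refl (mono j))))

      fresh-or-unmerged : ∀ x → mono⁺ x ≡ n ⊎ Σ (Fin n) λ y → x ≡ suc y × meetsMono s (mono y) ≡ false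
      fresh-or-unmerged zero = inj₁ refl
      fresh-or-unmerged (suc y) with NewMono.old-label y
      ... | inj₁ (_ , fresh) = inj₁ fresh
      ... | inj₂ (unmerged , _) = inj₂ (y , refl , unmerged)

      mono-edge⁺ : ∀ x y → adj⁺ x y ≡ true → colour⁺ x ≡ colour⁺ y → mono⁺ x ≡ mono⁺ y
      mono-edge⁺ zero zero () _
      mono-edge⁺ zero (suc j) e c = sym (neighbour-fresh j e (sym c))
      mono-edge⁺ (suc i) zero e c = neighbour-fresh i e c
      mono-edge⁺ (suc i) (suc j) e c = cong NewMono.relabel (mono-edge i j e c)

      mono-colour⁺ : ∀ x y → mono⁺ x ≡ mono⁺ y → colour⁺ x ≡ colour⁺ y
      mono-colour⁺ x y same with NewMono.same-label x y same
      ... | inj₁ (fx , fy) = trans (fresh-mono-colour x fx) (sym (fresh-mono-colour y fy))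
      ... | inj₂ (x′ , y′ , refl , refl , same′) = mono-colour x′ y′ same′

      mono⊆block⁺ : ∀ x y → mono⁺ x ≡ mono⁺ y → block⁺ x ≡ block⁺ y
      mono⊆block⁺ x y same with NewMono.same-label x y same
      ... | inj₁ (fx , fy) = trans (fresh-mono⇒fresh-block x fx) (sym (fresh-mono⇒fresh-block y fy))
      ... | inj₂ (x′ , y′ , refl , refl , same′) = cong NewBlock.relabel (mono⊆block x′ y′ same′)

      block-connected⁺ : ∀ x y → block⁺ x ≡ block⁺ y → Connected adj⁺ x y
      block-connected⁺ x y same with NewBlock.same-label x y same
      ... | inj₁ (fx , fy) = connected-trans (fresh-block-to x fx) (fresh-block-from y fy)
      ... | inj₂ (x′ , y′ , refl , refl , same′) = connected-lift (block-connected x′ y′ same′)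

      mono-small⁺ : ∀ x → classSize mono⁺ x < a (colour⁺ x)
      mono-small⁺ x with fresh-or-unmerged x
      ... | inj₁ fresh = begin-strict
        classSize mono⁺ x  ≡⟨ NewMono.fresh-class-size x fresh ⟩
        suc (N s)          <⟨ s-free ⟩
        a s                ≡⟨ cong a (fresh-mono-colour x fresh) ⟨
        a (colour⁺ x)      ∎
        where open ≤-Reasoning
      ... | inj₂ (y , refl , unmerged) = ≤-trans (s≤s (NewMono.unmerged-class-size y unmerged)) (mono-small y)

      block-large⁺ : ∀ x → classSize mono⁺ x * prefix r a (colour⁺ x) ≤ classSize block⁺ x
      block-large⁺ x with fresh-or-unmerged x
      ... | inj₁ fresh = begin
        classSize mono⁺ x * prefix r a (colour⁺ x)
          ≡⟨ cong₂ (λ m c → m * prefix r a c) (NewMono.fresh-class-size x fresh) (fresh-mono-colour x fresh) ⟩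
        suc (N s) * prefix r a s   ≤⟨ first-term≤1+weighted r a N s earlier-full ⟩
        suc (weighted r a N)       ≤⟨ s≤s weighted-N≤NB ⟩
        suc NB                     ≡⟨ NewBlock.fresh-class-size x (fresh-mono⇒fresh-block x fresh) ⟨
        classSize block⁺ x         ∎
        where open ≤-Reasoning
      ... | inj₂ (y , refl , unmerged) = begin
        classSize mono⁺ (suc y) * prefix r a (col B y)
          ≤⟨ *-monoˡ-≤ (prefix r a (col B y)) (NewMono.unmerged-class-size y unmerged) ⟩
        classSize mono y * prefix r a (col B y)  ≤⟨ block-large y ⟩
        classSize block y                        ≤⟨ NewBlock.class-size-grows y ⟩
        classSize block⁺ (suc y)                 ∎
        where open ≤-Reasoning

      invariant : Invariant (extend B S s)
      invariant = record
        { mono = mono⁺ ; block = block⁺ ; mono< = NewMono.L⁺< ; block< = NewBlock.L⁺<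
        ; mono-edge = mono-edge⁺ ; mono-colour = mono-colour⁺ ; mono⊆block = mono⊆block⁺
        ; block-connected = block-connected⁺ ; mono-small = mono-small⁺ ; block-large = block-large⁺ }

module Survival (r : ℕ) (F : Fin r → Graph) (trees : ∀ t → IsTree (F t))
                (k : ℕ) (k<prod : k < prod r (λ t → v (F t))) where
  a : Fin r → ℕ
  a t = v (F t)
  open PainterStrategy r a

  -- A monochromatic copy of the tree F s is connected, so it lies in a single
  -- monochromatic class, which has fewer than v (F s) vertices.
  no-mono-copy : ∀ {B} → Invariant B → ¬ PainterLost F B
  no-mono-copy I (s , f , f-injective , f-edges , f-colour) = <⇒≱ small large
    where
    open Invariant I
    ρ : Fin (v (F s))
    ρ = fromℕ< (IsTree.nonempty (trees s))

    small : classSize mono (f ρ) < a s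
    small = subst (λ c → classSize mono (f ρ) < a c) (f-colour ρ) (mono-small (f ρ))

    same-class : ∀ {u w} → Connected (adj (F s)) u w → mono (f u) ≡ mono (f w)
    same-class here = refl
    same-class (step {u} {u′} e c) =
      trans (mono-edge (f u) (f u′) (f-edges u u′ e) (trans (f-colour u) (sym (f-colour u′)))) (same-class c)

    large : a s ≤ classSize mono (f ρ)
    large = subst (_≤ classSize mono (f ρ)) (length-tabulate f)
      (unique-length≤count _ (tabulate f) (Unique.tabulate⁺ f-injective)
        (All.tabulate⁺ (λ b → ==-complete _ _ (sym (same-class (IsTree.connected (trees s) ρ b))))))

  painter-survives : ∀ {B} → Invariant B → ¬ BuilderWinsFrom k F B
  painter-survives I (lost painter-lost) = no-mono-copy I painter-lost
  painter-survives I (move S (forest , components≤k) next) = answer (Fin.all? full?)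
    where
    open Move I S forest
    full? : ∀ t → Dec (a t ≤ suc (N t))
    full? t = a t ≤? suc (N t)

    answer : Dec (∀ t → a t ≤ suc (N t)) → ⊥
    answer (yes all-full) = <⇒≱ k<prod (all-full⇒large k components≤k all-full)
    answer (no not-all-full) with Fin.¬∀⟶∃¬-smallest r _ full? not-all-full
    ... | s , s-free , earlier-full =
      painter-survives (Answer.invariant s (≰⇒> s-free) earlier-full) (next s)

lemma8 : (r : ℕ) → 2 ≤ r → (F : Fin r → Graph) → (∀ i → IsTree (F i)) →
    (k : ℕ) → BuilderWins k F → prod r (λ i → v (F i)) ≤ k
lemma8 r _ F trees k builder-wins = ≮⇒≥ λ k<prod →
  Survival.painter-survives r F trees k k<prod (PainterStrategy.initial r (λ t → v (F t))) builder-wins
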